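{- Let $\varphi(x_1,\ldots,x_n)$ be an expression and $a_1,\ldots,a_n\in\mathrm{M}$ with $|\varphi(a_1,\ldots,a_n)|=|a_i|$ over $\mathrm{M}$, where the variables are indexed so that $|a_1|\le\cdots\le|a_{i-1}|<|a_i|\le\cdots\le|a_n|$. Then, when $\varphi$ is evaluated in the two-element Boolean algebra $\mathrm{B}_2=\{\mathrm{T},\mathrm{F}\}$, the value $\varphi(b_1,\ldots,b_n)$ for $b_1,\ldots,b_n\in\{\mathrm{T},\mathrm{F}\}$ does not depend on $b_1,\ldots,b_{i-1}$ as long as $b_j=p(a_j)$ for every $j\ge i$.
   Context: $\mathrm{M}$ denotes the set $\widehat{\mathbb{Z}}=(\mathbb{Z}\setminus\{0\})\cup\{ -\infty,\infty\}$, totally ordered in the usual way, with $a\land b=\min(a,b)$, $a\lor b=\max(a,b)$ and $\lnot a=-a$ (with $|\pm\infty|=\infty$). An expression is a propositional formula built from variables using only $\land,\lor,\lnot$ (no constants), which can be evaluated both in $\mathrm{M}$ and in $\mathrm{B}_2$ with the usual Boolean operations. The map $p:\mathrm{M}\to\mathrm{B}_2$ is $p(a)=\mathrm{F}$ if $a<0$ and $p(a)=\mathrm{T}$ if $a>0$. -}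

module Defs where

open import Data.Bool using (Bool; true; false; T; not; if_then_else_; _∧_; _∨_)
open import Data.Nat using (ℕ; zero; suc)
open import Data.Integer using (ℤ; +_; -[1+_]; +[1+_]; ∣_∣; NonZero; _≤ᵇ_)
open import Data.Fin using (Fin)

data M : Set where
  -∞  : M
  +∞  : M
  fin : (z : ℤ) → NonZero z → M

_≤ᵇᴹ_ : M → M → Bool
-∞       ≤ᵇᴹ _        = true
+∞       ≤ᵇᴹ +∞       = true
+∞       ≤ᵇᴹ _        = false
fin _ _  ≤ᵇᴹ -∞       = false
fin _ _  ≤ᵇᴹ +∞       = true
fin a _  ≤ᵇᴹ fin b _  = a ≤ᵇ b

_≤ᴹ_ : M → M → Set
a ≤ᴹ b = T (a ≤ᵇᴹ b)

_<ᴹ_ : M → M → Set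
a <ᴹ b = T (not (b ≤ᵇᴹ a))

_⊓_ : M → M → M
a ⊓ b = if a ≤ᵇᴹ b then a else b

_⊔_ : M → M → M
a ⊔ b = if a ≤ᵇᴹ b then b else a

negᴹ : M → M
negᴹ -∞ = +∞
negᴹ +∞ = -∞
negᴹ (fin +[1+ n ] _) = fin -[1+ n ] _
negᴹ (fin -[1+ n ] _) = fin +[1+ n ] _

absᴹ : M → M
absᴹ -∞ = +∞
absᴹ +∞ = +∞
absᴹ (fin +[1+ n ] _) = fin +[1+ n ] _
absᴹ (fin -[1+ n ] _) = fin +[1+ n ] _

p : M → Bool
p -∞ = false
p +∞ = true
p (fin +[1+ n ] _) = true
p (fin -[1+ n ] _) = false

data Expr (n : ℕ) : Set where
  var  : Fin n → Expr n
  _∧ₑ_ : Expr n → Expr n → Expr n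
  _∨ₑ_ : Expr n → Expr n → Expr n
  ¬ₑ_  : Expr n → Expr n

evalM : ∀ {n} → Expr n → (Fin n → M) → M
evalM (var x)   a = a x
evalM (φ ∧ₑ ψ) a = evalM φ a ⊓ evalM ψ a
evalM (φ ∨ₑ ψ) a = evalM φ a ⊔ evalM ψ a
evalM (¬ₑ φ)   a = negᴹ (evalM φ a)

evalB : ∀ {n} → Expr n → (Fin n → Bool) → Bool
evalB (var x)   b = b x
evalB (φ ∧ₑ ψ) b = evalB φ b ∧ evalB ψ b
evalB (φ ∨ₑ ψ) b = evalB φ b ∨ evalB ψ b
evalB (¬ₑ φ)   b = not (evalB φ b)

-- Fix the threshold c = |a_i| and call a value of M large if its
-- absolute value is at least c. By induction on φ, every subexpression ψ whose
-- value in M is large already has its Boolean value determined: ψ(b) = p(ψ(a))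
-- for every b with b_j = p(a_j) whenever a_j is large. The key case is a
-- minimum u ⊓ w = u with u ≤ w: if u < 0 then p(u) = F decides the conjunction,
-- and if u > 0 then also 0 < u ≤ w, so w is large as well and both conjuncts
-- are T; maxima are dual and negation preserves both |·| and the sign. The
-- variables a_j with j < i are exactly the ones that are not large.
module Submission where

open import Defs
open import Data.Nat using (ℕ)
open import Data.Fin using (Fin; _≤_; _<_)
open import Data.Bool using (Bool; true; false; not; _∧_; _∨_)
open import Data.Bool.Properties using (∧-comm; ∨-comm; T-≡; T-not-≡)
open import Function.Bundles using (Equivalence)
open import Data.Sum using (inj₁; inj₂)
open import Data.Integer using (+[1+_]; -[1+_])
import Data.Integer.Properties as ℤ
import Data.Nat.Properties as ℕ
import Data.Fin.Properties as Fin
open import Relation.Nullary using (¬_; yes; no; contradiction)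
open import Relation.Binary.PropositionalEquality using (_≡_; refl; sym; trans; cong; subst)

<ᴹ⇒≱ᴹ : ∀ x y → x <ᴹ y → ¬ (y ≤ᴹ x)
<ᴹ⇒≱ᴹ x y x<y y≤x with y ≤ᵇᴹ x
<ᴹ⇒≱ᴹ x y () _ | true

≤ᴹ-refl : ∀ x → x ≤ᴹ x
≤ᴹ-refl -∞        = _
≤ᴹ-refl +∞        = _
≤ᴹ-refl (fin x _) = ℤ.≤⇒≤ᵇ (ℤ.≤-refl {x})

≤ᴹ-trans : ∀ x y z → x ≤ᴹ y → y ≤ᴹ z → x ≤ᴹ z
≤ᴹ-trans -∞        _         _         _   _   = _
≤ᴹ-trans +∞        +∞        +∞        _   _   = _
≤ᴹ-trans (fin _ _) _         +∞        _   _   = _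
≤ᴹ-trans (fin x _) (fin y _) (fin z _) x≤y y≤z =
  ℤ.≤⇒≤ᵇ (ℤ.≤-trans (ℤ.≤ᵇ⇒≤ {x} {y} x≤y) (ℤ.≤ᵇ⇒≤ {y} {z} y≤z))
≤ᴹ-trans +∞        +∞        -∞        _   ()
≤ᴹ-trans +∞        +∞        (fin _ _) _   ()
≤ᴹ-trans +∞        -∞        _         ()  _
≤ᴹ-trans +∞        (fin _ _) _         ()  _
≤ᴹ-trans (fin _ _) -∞        _         ()  _
≤ᴹ-trans (fin _ _) +∞        (fin _ _) _   ()
≤ᴹ-trans (fin _ _) (fin _ _) -∞        _   ()

<ᴹ⇒≤ᴹ : ∀ x y → x <ᴹ y → x ≤ᴹ y
<ᴹ⇒≤ᴹ -∞        _         _   = _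
<ᴹ⇒≤ᴹ (fin _ _) +∞        _   = _
<ᴹ⇒≤ᴹ +∞        -∞        ()
<ᴹ⇒≤ᴹ +∞        +∞        ()
<ᴹ⇒≤ᴹ +∞        (fin _ _) ()
<ᴹ⇒≤ᴹ (fin _ _) -∞        ()
<ᴹ⇒≤ᴹ u@(fin x _) v@(fin y _) x<y with ℤ.≤-total x y
... | inj₁ x≤y = ℤ.≤⇒≤ᵇ x≤y
... | inj₂ y≤x = contradiction (ℤ.≤⇒≤ᵇ y≤x) (<ᴹ⇒≱ᴹ u v x<y)

p-mono : ∀ u w → u ≤ᴹ w → p u ≡ true → p w ≡ true
p-mono _                +∞               _  _  = refl
p-mono _                (fin +[1+ _ ] _) _  _  = refl
p-mono -∞               -∞               _  ()
p-mono -∞               (fin -[1+ _ ] _) _  ()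
p-mono (fin -[1+ _ ] _) _                _  ()
p-mono +∞               -∞               () _
p-mono +∞               (fin -[1+ _ ] _) () _
p-mono (fin +[1+ _ ] _) -∞               () _
p-mono (fin +[1+ _ ] _) (fin -[1+ _ ] _) () _

p-mono-false : ∀ u w → u ≤ᴹ w → p w ≡ false → p u ≡ false
p-mono-false u w u≤w pw≡false with p u in pu
... | false = refl
... | true  = trans (sym (p-mono u w u≤w pu)) pw≡false

absᴹ-mono-pos : ∀ u w → u ≤ᴹ w → p u ≡ true → absᴹ u ≤ᴹ absᴹ w
absᴹ-mono-pos +∞               +∞               _   _  = _
absᴹ-mono-pos (fin +[1+ _ ] _) +∞               _   _  = _
absᴹ-mono-pos (fin +[1+ _ ] _) (fin +[1+ _ ] _) u≤w _  = u≤w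
absᴹ-mono-pos -∞               _                _   ()
absᴹ-mono-pos (fin -[1+ _ ] _) _                _   ()
absᴹ-mono-pos +∞               -∞               ()  _
absᴹ-mono-pos +∞               (fin _ _)        ()  _
absᴹ-mono-pos (fin +[1+ _ ] _) -∞               ()  _
absᴹ-mono-pos (fin +[1+ _ ] _) (fin -[1+ _ ] _) ()  _

absᴹ-antimono-neg : ∀ u w → u ≤ᴹ w → p w ≡ false → absᴹ w ≤ᴹ absᴹ u
absᴹ-antimono-neg -∞                 -∞                 _   _  = _
absᴹ-antimono-neg -∞                 (fin -[1+ _ ] _)   _   _  = _
absᴹ-antimono-neg (fin -[1+ m ] _)   (fin -[1+ n ] _)   u≤w _  =
  ℤ.≤⇒≤ᵇ (ℤ.neg-mono-≤ (ℤ.≤ᵇ⇒≤ { -[1+ m ]} { -[1+ n ]} u≤w))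
absᴹ-antimono-neg _                  +∞                 _   ()
absᴹ-antimono-neg _                  (fin +[1+ _ ] _)   _   ()
absᴹ-antimono-neg +∞                 -∞                 ()  _
absᴹ-antimono-neg +∞                 (fin -[1+ _ ] _)   ()  _
absᴹ-antimono-neg (fin +[1+ _ ] _)   -∞                 ()  _
absᴹ-antimono-neg (fin +[1+ _ ] _)   (fin -[1+ _ ] _)   ()  _
absᴹ-antimono-neg (fin -[1+ _ ] _)   -∞                 ()  _

absᴹ-negᴹ : ∀ v → absᴹ (negᴹ v) ≡ absᴹ v
absᴹ-negᴹ -∞               = refl
absᴹ-negᴹ +∞               = refl
absᴹ-negᴹ (fin +[1+ _ ] _) = refl
absᴹ-negᴹ (fin -[1+ _ ] _) = refl

p-negᴹ : ∀ v → p (negᴹ v) ≡ not (p v)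
p-negᴹ -∞               = refl
p-negᴹ +∞               = refl
p-negᴹ (fin +[1+ _ ] _) = refl
p-negᴹ (fin -[1+ _ ] _) = refl

module _ (c : M) where

  Large : M → Set
  Large v = c ≤ᴹ absᴹ v

  SignedBy : Bool → M → Set
  SignedBy x v = Large v → x ≡ p v

  ∧-signedBy-min : ∀ {x y} u w → u ≤ᴹ w →
    SignedBy x u → SignedBy y w → Large u → x ∧ y ≡ p u
  ∧-signedBy-min {x} {y} u w u≤w hu hw large-u with p u in pu
  ... | false rewrite hu large-u = refl
  ... | true  rewrite hu large-u
                    | hw (≤ᴹ-trans c (absᴹ u) (absᴹ w) large-u (absᴹ-mono-pos u w u≤w pu))
                    | p-mono u w u≤w pu = refl

  ∨-signedBy-max : ∀ {x y} u w → u ≤ᴹ w →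
    SignedBy x u → SignedBy y w → Large w → x ∨ y ≡ p w
  ∨-signedBy-max {x} {y} u w u≤w hu hw large-w with p w in pw
  ... | true  rewrite hw large-w = ∨-comm x true
  ... | false rewrite hw large-w
                    | hu (≤ᴹ-trans c (absᴹ w) (absᴹ u) large-w (absᴹ-antimono-neg u w u≤w pw))
                    | p-mono-false u w u≤w pw = refl

  ∧-signedBy-⊓ : ∀ {x y} u w → SignedBy x u → SignedBy y w → SignedBy (x ∧ y) (u ⊓ w)
  ∧-signedBy-⊓ {x} {y} u w hu hw with u ≤ᵇᴹ w in u≤w
  ... | true  = ∧-signedBy-min u w (Equivalence.from T-≡ u≤w) hu hw
  ... | false = λ large-w →
    trans (∧-comm x y) (∧-signedBy-min w u (<ᴹ⇒≤ᴹ w u (Equivalence.from T-not-≡ u≤w)) hw hu large-w)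

  ∨-signedBy-⊔ : ∀ {x y} u w → SignedBy x u → SignedBy y w → SignedBy (x ∨ y) (u ⊔ w)
  ∨-signedBy-⊔ {x} {y} u w hu hw with u ≤ᵇᴹ w in u≤w
  ... | true  = ∨-signedBy-max u w (Equivalence.from T-≡ u≤w) hu hw
  ... | false = λ large-u →
    trans (∨-comm x y) (∨-signedBy-max w u (<ᴹ⇒≤ᴹ w u (Equivalence.from T-not-≡ u≤w)) hw hu large-u)

  evalB-signedBy-evalM : ∀ {n} (a : Fin n → M) (b : Fin n → Bool) →
    (∀ j → SignedBy (b j) (a j)) → ∀ φ → SignedBy (evalB φ b) (evalM φ a)
  evalB-signedBy-evalM a b hb (var j)  = hb j
  evalB-signedBy-evalM a b hb (φ ∧ₑ ψ) =
    ∧-signedBy-⊓ (evalM φ a) (evalM ψ a) (evalB-signedBy-evalM a b hb φ) (evalB-signedBy-evalM a b hb ψ)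
  evalB-signedBy-evalM a b hb (φ ∨ₑ ψ) =
    ∨-signedBy-⊔ (evalM φ a) (evalM ψ a) (evalB-signedBy-evalM a b hb φ) (evalB-signedBy-evalM a b hb ψ)
  evalB-signedBy-evalM a b hb (¬ₑ φ) large rewrite p-negᴹ (evalM φ a) =
    cong not (evalB-signedBy-evalM a b hb φ (subst (c ≤ᴹ_) (absᴹ-negᴹ (evalM φ a)) large))

-- The hypothesis that all of a is sorted by absolute value is not needed:
-- it suffices that the variables before i are smaller than a_i.
theorem1 : (n : ℕ) (φ : Expr n) (a : Fin n → M) (i : Fin n)
    → (∀ j k → j ≤ k → absᴹ (a j) ≤ᴹ absᴹ (a k))
    → (∀ j → j < i → absᴹ (a j) <ᴹ absᴹ (a i))
    → absᴹ (evalM φ a) ≡ absᴹ (a i)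
    → (b b′ : Fin n → Bool)
    → (∀ j → i ≤ j → b j ≡ p (a j))
    → (∀ j → i ≤ j → b′ j ≡ p (a j))
    → evalB φ b ≡ evalB φ b′
theorem1 n φ a i _ smaller-before-i |φa|≡|ai| b b′ hb hb′ =
  trans (evalB≡p-evalM b hb) (sym (evalB≡p-evalM b′ hb′))
  where
  c : M
  c = absᴹ (a i)

  large⇒i≤ : ∀ j → Large c (a j) → i ≤ j
  large⇒i≤ j large with i Fin.≤? j
  ... | yes i≤j = i≤j
  ... | no  i≰j = contradiction large (<ᴹ⇒≱ᴹ (absᴹ (a j)) c (smaller-before-i j (ℕ.≰⇒> i≰j)))

  evalB≡p-evalM : ∀ b → (∀ j → i ≤ j → b j ≡ p (a j)) → evalB φ b ≡ p (evalM φ a)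
  evalB≡p-evalM b hb =
    evalB-signedBy-evalM c a b (λ j large → hb j (large⇒i≤ j large)) φ
      (subst (c ≤ᴹ_) (sym |φa|≡|ai|) (≤ᴹ-refl c))
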